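{- Let $\mathcal{S}_{\mathrm{lex}}$ be the set of PB constraints below. There is a cutting planes derivation of size $O(n)$ of the constraint $f_n\ge1$ from $$\mathcal{S}_{\mathrm{lex}}(\vec{x},\vec{y},\vec{a},\vec{d})\cup\{d_n\ge1\}\cup\mathcal{S}_{\mathrm{lex}}(\vec{y},\vec{w},\vec{b},\vec{e})\cup\{e_n\ge1\}\cup\mathcal{S}_{\mathrm{lex}}(\vec{x},\vec{w},\vec{c},\vec{f}),$$ where $\vec{x},\vec{y},\vec{w}$ are lists of $n$ variables and $\vec{a},\vec{b},\vec{c}$ (length $n-1$) and $\vec{d},\vec{e},\vec{f}$ (length $n$) are lists of auxiliary variables, all pairwise disjoint. (Thus transitivity of the order defined by $\mathcal{O}=\{d_n\ge1\}$ and $\mathcal{S}_{\mathrm{lex}}$ can be proven with such a derivation.)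
   Context: Literals: $x$ or $\bar x=1-x$. For $n\ge1$, $\mathcal{S}_{\mathrm{lex}}(\vec{x},\vec{y},\vec{a},\vec{d})$ (over $x_1..x_n$, $y_1..y_n$, $a_1..a_{n-1}$, $d_1..d_n$) consists of: $\bar a_1+x_1+\bar y_1\ge1$; $2a_1+\bar x_1+y_1\ge2$; for $1\le i\le n-2$: $3\bar a_{i+1}+2a_i+x_{i+1}+\bar y_{i+1}\ge3$ and $2a_{i+1}+2\bar a_i+\bar x_{i+1}+y_{i+1}\ge2$; $\bar d_1+y_1+\bar x_1\ge1$; $2d_1+\bar y_1+x_1\ge2$; for $1\le i\le n-1$: $4\bar d_{i+1}+3d_i+\bar a_i+y_{i+1}+\bar x_{i+1}\ge4$ and $4d_{i+1}+3\bar d_i+a_i+\bar y_{i+1}+x_{i+1}\ge3$. $\mathcal{S}_{\mathrm{lex}}(\vec{y},\vec{w},\vec{b},\vec{e})$ etc. denote the same constraints with the variable lists renamed accordingly. Cutting planes derivations use literal axioms $\ell\ge0$, positive integer multiplication, addition, saturation, weakening and division with rounding up; the size of a derivation is the total size of the constraints in it (here: number of steps times the bounded size of each constraint). -}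

module Defs where

open import Data.Bool using (Bool; true; false; if_then_else_; _∧_)
open import Data.Nat as ℕ using (ℕ; zero; suc; _≡ᵇ_; _⊓_; _∸_)
open import Data.Nat.DivMod using (_/_)
open import Data.Nat.ListAction using (sum)
open import Data.Nat.Logarithm using (⌊log₂_⌋)
open import Data.Integer as ℤ using (ℤ; +_; -[1+_]; -_; ∣_∣)
open import Data.List using (List; []; _∷_; map; length; applyUpTo; _++_; concat)
open import Data.List.Membership.Propositional using (_∈_)
open import Data.List.Relation.Unary.Any using (Any)
open import Data.List.Relation.Unary.Unique.Propositional using (Unique)
open import Data.Product using (_×_; _,_; proj₁; proj₂; Σ; ∃)
open import Relation.Binary.PropositionalEquality using (_≡_; _≢_)

-- Variables.  Nine pairwise disjoint families of variables, indexed by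
-- ℕ (indices start at 1, as in the paper).

data Var : Set where
  x y w a b c d e f : ℕ → Var

tag : Var → ℕ
tag (x _) = 0
tag (y _) = 1
tag (w _) = 2
tag (a _) = 3
tag (b _) = 4
tag (c _) = 5
tag (d _) = 6
tag (e _) = 7
tag (f _) = 8

idx : Var → ℕ
idx (x i) = i
idx (y i) = i
idx (w i) = i
idx (a i) = i
idx (b i) = i
idx (c i) = i
idx (d i) = i
idx (e i) = i
idx (f i) = i

_==ᵛ_ : Var → Var → Bool
u ==ᵛ v = (tag u ≡ᵇ tag v) ∧ (idx u ≡ᵇ idx v)

data Lit : Set where
  pos : Var → Lit
  neg : Var → Lit

litVar : Lit → Var
litVar (pos v) = v
litVar (neg v) = v

Term : Set
Term = ℕ × Lit

infix 6 _≥ᴾ_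
record PB : Set where
  constructor _≥ᴾ_
  field
    terms  : List Term
    degree : ℤ
open PB public

Canonical : PB → Set
Canonical C = Unique (map (λ t → litVar (proj₂ t)) (terms C))

-- Linear (integer) reading of a constraint:  Σ_v lin C v · v ≥ ldeg C,
-- where a·v̄ is read as a - a·v.
termCoef : Var → Term → ℤ
termCoef v (k , pos u) = if u ==ᵛ v then + k else + 0
termCoef v (k , neg u) = if u ==ᵛ v then - (+ k) else + 0

lin : PB → Var → ℤ
lin C v = sumℤ (map (termCoef v) (terms C))
  where
  sumℤ : List ℤ → ℤ
  sumℤ []       = + 0
  sumℤ (z ∷ zs) = z ℤ.+ sumℤ zs

negMass : List Term → ℕ
negMass []                 = 0
negMass ((k , pos _) ∷ ts) = negMass ts
negMass ((k , neg _) ∷ ts) = k ℕ.+ negMass ts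

ldeg : PB → ℤ
ldeg C = degree C ℤ.- (+ negMass (terms C))

_≈_ : PB → PB → Set
C ≈ D = (∀ v → lin C v ≡ lin D v) × (ldeg C ≡ ldeg D)

posPart : ℤ → ℕ
posPart (+ n)    = n
posPart -[1+ _ ] = 0

satCoef : ℤ → ℤ → ℤ
satCoef A (+ m)    = + (m ⊓ posPart A)
satCoef A -[1+ m ] = - (+ (suc m ⊓ posPart A))

ceilDiv : ℕ → ℕ → ℕ
ceilDiv m k = (m ℕ.+ k) / suc k

divCoef : ℕ → ℤ → ℤ
divCoef k (+ m)    = + ceilDiv m k
divCoef k -[1+ m ] = - (+ ceilDiv (suc m) k)

ceilDivℤ : ℤ → ℕ → ℤ
ceilDivℤ (+ m)    k = + ceilDiv m k
ceilDivℤ -[1+ m ] k = - (+ (suc m / suc k))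

-- A new line R is justified w.r.t. the premise
-- set Γ and the list ls of earlier lines.  (All lines are canonical, so
-- for a line its literal-form degree is its normalized degree.)

data Step (Γ : List PB) (ls : List PB) (R : PB) : Set where
  premise  : ∀ {P} → P ∈ Γ → R ≈ P → Step Γ ls R
  axPos    : ∀ v → R ≈ (((1 , pos v) ∷ []) ≥ᴾ + 0) → Step Γ ls R
  axNeg    : ∀ v → R ≈ (((1 , neg v) ∷ []) ≥ᴾ + 0) → Step Γ ls R
  mult     : ∀ {P} k → P ∈ ls →
             (∀ v → lin R v ≡ + suc k ℤ.* lin P v) →
             ldeg R ≡ + suc k ℤ.* ldeg P → Step Γ ls R
  add      : ∀ {P Q} → P ∈ ls → Q ∈ ls →
             (∀ v → lin R v ≡ lin P v ℤ.+ lin Q v) →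
             ldeg R ≡ ldeg P ℤ.+ ldeg Q → Step Γ ls R
  saturate : ∀ {P} → P ∈ ls →
             (∀ v → lin R v ≡ satCoef (degree P) (lin P v)) →
             degree R ≡ degree P → Step Γ ls R
  weaken   : ∀ {P} u → P ∈ ls →
             lin R u ≡ + 0 →
             (∀ v → v ≢ u → lin R v ≡ lin P v) →
             degree R ≡ degree P ℤ.- (+ ∣ lin P u ∣) → Step Γ ls R
  divide   : ∀ {P} k → P ∈ ls →
             (∀ v → lin R v ≡ divCoef k (lin P v)) →
             degree R ≡ ceilDivℤ (degree P) k → Step Γ ls R

-- A derivation from Γ, listing its lines latest-first.
data Deriv (Γ : List PB) : List PB → Set where
  []   : Deriv Γ []
  _▷_  : ∀ {ls R} → Deriv Γ ls → Canonical R × Step Γ ls R → Deriv Γ (R ∷ ls)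

bits : ℕ → ℕ
bits m = suc ⌊log₂ m ⌋

sizePB : PB → ℕ
sizePB C = sum (map (λ t → bits (proj₁ t)) (terms C)) ℕ.+ bits ∣ degree C ∣

size : List PB → ℕ
size ls = sum (map sizePB ls)

from1 : ℕ → List ℕ
from1 m = applyUpTo suc m

Slex : (X Y A D : ℕ → Var) → ℕ → List PB
Slex X Y A D n =
    ((1 , neg (A 1)) ∷ (1 , pos (X 1)) ∷ (1 , neg (Y 1)) ∷ []) ≥ᴾ + 1
  ∷ ((2 , pos (A 1)) ∷ (1 , neg (X 1)) ∷ (1 , pos (Y 1)) ∷ []) ≥ᴾ + 2
  ∷ ((1 , neg (D 1)) ∷ (1 , pos (Y 1)) ∷ (1 , neg (X 1)) ∷ []) ≥ᴾ + 1
  ∷ ((2 , pos (D 1)) ∷ (1 , neg (Y 1)) ∷ (1 , pos (X 1)) ∷ []) ≥ᴾ + 2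
  ∷ concat (map (λ i →
        ((3 , neg (A (suc i))) ∷ (2 , pos (A i)) ∷ (1 , pos (X (suc i))) ∷ (1 , neg (Y (suc i))) ∷ []) ≥ᴾ + 3
      ∷ ((2 , pos (A (suc i))) ∷ (2 , neg (A i)) ∷ (1 , neg (X (suc i))) ∷ (1 , pos (Y (suc i))) ∷ []) ≥ᴾ + 2
      ∷ []) (from1 (n ∸ 2)))
  ++ concat (map (λ i →
        ((4 , neg (D (suc i))) ∷ (3 , pos (D i)) ∷ (1 , neg (A i)) ∷ (1 , pos (Y (suc i))) ∷ (1 , neg (X (suc i))) ∷ []) ≥ᴾ + 4
      ∷ ((4 , pos (D (suc i))) ∷ (3 , neg (D i)) ∷ (1 , pos (A i)) ∷ (1 , neg (Y (suc i))) ∷ (1 , pos (X (suc i))) ∷ []) ≥ᴾ + 3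
      ∷ []) (from1 (n ∸ 1)))

Γtrans : ℕ → List PB
Γtrans n =
     Slex x y a d n
  ++ (((1 , pos (d n)) ∷ []) ≥ᴾ + 1)
  ∷  Slex y w b e n
  ++ (((1 , pos (e n)) ∷ []) ≥ᴾ + 1)
  ∷  Slex x w c f n

target : ℕ → PB
target n = ((1 , pos (f n)) ∷ []) ≥ᴾ + 1

DerivationOfSize≤ : List PB → PB → ℕ → Set
DerivationOfSize≤ Γ T s =
  Σ (List PB) λ ls → Deriv Γ ls × Any (_≈ T) ls × size ls ℕ.≤ s

module Submission where

{-
Read d_i as "x ≤_lex y on the first i positions" and a_i as "x_j ≥ y_j for all j ≤ i";
likewise e_i, b_i compare y with w, and f_i, c_i compare x with w. By induction on i
one derives the clauses

  I₁ :  d̄_i + ē_i + f_i ≥ 1                   (the prefix order is transitive),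
  I₂ :  c̄_i + d̄_i + ē_i + a_i ≥ 1
  I₃ :  c̄_i + d̄_i + ē_i + b_i ≥ 1             (if x ≤ y ≤ w and x_j ≥ w_j for j ≤ i,
                                                the three prefixes agree).

The constraints of S_lex linking the indices i and i + 1 have the same shape for every i,
so one cutting planes derivation over the eighteen variables of the window {i, i + 1},
checked once by computation, carries the clauses from i to i + 1 for every i. Chaining
these windows derives I₁ at index n with size O(n), and adding d_n ≥ 1 and e_n ≥ 1 to
it gives f_n ≥ 1.
-}

open import Defs
open import Data.Nat using (ℕ; _≤_; _*_)
open import Data.Product using (∃)

open import Data.Bool using (true; false; T; if_then_else_)
open import Data.Bool.Properties using (T-∧; T-≡)
open import Data.Empty using (⊥-elim)
open import Data.Integer as ℤ using (ℤ; +_; -_; ∣_∣)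
open import Data.List using (List; []; _∷_; _++_; map; take; drop; cartesianProduct)
open import Data.List.Membership.Propositional using (_∈_; find; lose)
open import Data.List.Membership.Propositional.Properties
  using (∈-map⁺; ∈-++⁺ˡ; ∈-++⁺ʳ; ∈-++⁻; ∈-concat⁺′; ∈-applyUpTo⁺; ∈-cartesianProduct⁺)
open import Data.List.Properties using (map-∘; ++-assoc; take++drop≡id)
import Data.List.Relation.Unary.All as All
open import Data.List.Relation.Unary.Any as Any using (Any; here; there)
import Data.List.Relation.Unary.Any.Properties as Any
open import Data.List.Relation.Unary.Unique.Propositional using (Unique)
import Data.List.Relation.Unary.Unique.Propositional.Properties as Unique
open import Data.Maybe using (Maybe; just; nothing)
open import Data.Nat as ℕ using (suc; zero; _≟_; _<_; _∸_; z≤n)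
open import Data.Nat.ListAction using (sum)
open import Data.Nat.Properties
  using (≡ᵇ⇒≡; ≡⇒≡ᵇ; ≤ᵇ⇒≤; 1+n≢n; +-assoc; +-comm; +-mono-≤; *-suc; ∸-monoˡ-≤; ≤-refl; <-trans; n<1+n;
         module ≤-Reasoning)
import Data.Product.Properties as Product
open import Data.Product using (_×_; _,_; proj₁; proj₂; map₁; map₂)
open import Data.Sum using (_⊎_; inj₁; inj₂; [_,_])
open import Data.Unit using (⊤; tt)
open import Function using (_∘_; Equivalence)
open import Relation.Binary.Definitions using (DecidableEquality)
open import Relation.Binary.PropositionalEquality
  using (_≡_; _≢_; refl; sym; trans; cong; cong₂; subst; module ≡-Reasoning)
open import Relation.Nullary using (Dec; yes; no; ¬?; _×-dec_; _⊎-dec_; _→-dec_)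
open import Relation.Nullary.Decidable using (⌊_⌋; map′; from-yes)

-- Variables of a window

data Family : Set where
  X Y W A B C D E F : Family

family : Family → ℕ → Var
family X = x
family Y = y
family W = w
family A = a
family B = b
family C = c
family D = d
family E = e
family F = f

familyOfTag : ℕ → Family
familyOfTag 0 = X
familyOfTag 1 = Y
familyOfTag 2 = W
familyOfTag 3 = A
familyOfTag 4 = B
familyOfTag 5 = C
familyOfTag 6 = D
familyOfTag 7 = E
familyOfTag _ = F

familyOfTag-tag : ∀ φ k → familyOfTag (tag (family φ k)) ≡ φ
familyOfTag-tag X k = refl
familyOfTag-tag Y k = refl
familyOfTag-tag W k = refl
familyOfTag-tag A k = refl
familyOfTag-tag B k = refl
familyOfTag-tag C k = refl
familyOfTag-tag D k = refl
familyOfTag-tag E k = refl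
familyOfTag-tag F k = refl

idx-family : ∀ φ k → idx (family φ k) ≡ k
idx-family X k = refl
idx-family Y k = refl
idx-family W k = refl
idx-family A k = refl
idx-family B k = refl
idx-family C k = refl
idx-family D k = refl
idx-family E k = refl
idx-family F k = refl

family-idx : ∀ v → family (familyOfTag (tag v)) (idx v) ≡ v
family-idx (x _) = refl
family-idx (y _) = refl
family-idx (w _) = refl
family-idx (a _) = refl
family-idx (b _) = refl
family-idx (c _) = refl
family-idx (d _) = refl
family-idx (e _) = refl
family-idx (f _) = refl

tag-family-injective : ∀ {φ ψ k l} → tag (family φ k) ≡ tag (family ψ l) → φ ≡ ψ
tag-family-injective {φ} {ψ} {k} {l} eq =
  trans (sym (familyOfTag-tag φ k)) (trans (cong familyOfTag eq) (familyOfTag-tag ψ l))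

family-injective : ∀ {φ ψ k l} → family φ k ≡ family ψ l → φ ≡ ψ × k ≡ l
family-injective {φ} {ψ} {k} {l} eq =
  tag-family-injective (cong tag eq) , trans (sym (idx-family φ k)) (trans (cong idx eq) (idx-family ψ l))

_≟ᶠ_ : DecidableEquality Family
φ ≟ᶠ ψ = map′ tag-family-injective (cong (λ χ → tag (family χ 0))) (tag (family φ 0) ≟ tag (family ψ 0))

==ᵛ⇒≡ : ∀ {u v} → T (u ==ᵛ v) → u ≡ v
==ᵛ⇒≡ {u} {v} h =
  let tags , idxs = Equivalence.to T-∧ h
  in begin
       u                                     ≡⟨ family-idx u ⟨
       family (familyOfTag (tag u)) (idx u)  ≡⟨ cong₂ (family ∘ familyOfTag) (≡ᵇ⇒≡ _ _ tags) (≡ᵇ⇒≡ _ _ idxs) ⟩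
       family (familyOfTag (tag v)) (idx v)  ≡⟨ family-idx v ⟩
       v                                     ∎
  where open ≡-Reasoning

==ᵛ-refl : ∀ u → (u ==ᵛ u) ≡ true
==ᵛ-refl u = Equivalence.to T-≡ (Equivalence.from T-∧ (≡⇒≡ᵇ (tag u) _ refl , ≡⇒≡ᵇ (idx u) _ refl))

==ᵛ-≢ : ∀ {u v} → u ≢ v → (u ==ᵛ v) ≡ false
==ᵛ-≢ {u} {v} u≢v with u ==ᵛ v in eq
... | false = refl
... | true  = ⊥-elim (u≢v (==ᵛ⇒≡ (Equivalence.from T-≡ eq)))

data Offset : Set where
  ₀ ₁ : Offset

_≟ᵒ_ : DecidableEquality Offset
₀ ≟ᵒ ₀ = yes refl
₀ ≟ᵒ ₁ = no λ ()
₁ ≟ᵒ ₀ = no λ ()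
₁ ≟ᵒ ₁ = yes refl

shift : Offset → ℕ → ℕ
shift ₀ i = i
shift ₁ i = suc i

shift-injective : ∀ {o o′} i → shift o i ≡ shift o′ i → o ≡ o′
shift-injective {₀} {₀} i _  = refl
shift-injective {₀} {₁} i eq = ⊥-elim (1+n≢n (sym eq))
shift-injective {₁} {₀} i eq = ⊥-elim (1+n≢n eq)
shift-injective {₁} {₁} i _  = refl

Atom : Set
Atom = Family × Offset

_≟ᵃ_ : DecidableEquality Atom
_≟ᵃ_ = Product.≡-dec _≟ᶠ_ _≟ᵒ_

open import Data.List.Relation.Unary.Unique.DecPropositional _≟ᵃ_ using (unique?)

families : List Family
families = X ∷ Y ∷ W ∷ A ∷ B ∷ C ∷ D ∷ E ∷ F ∷ []

atoms : List Atom
atoms = cartesianProduct families (₀ ∷ ₁ ∷ [])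

atom∈atoms : ∀ s → s ∈ atoms
atom∈atoms (φ , o) = ∈-cartesianProduct⁺ (family∈ φ) (offset∈ o)
  where
  family∈ : ∀ φ → φ ∈ families
  family∈ X = here refl
  family∈ Y = there (here refl)
  family∈ W = there (there (here refl))
  family∈ A = there (there (there (here refl)))
  family∈ B = there (there (there (there (here refl))))
  family∈ C = there (there (there (there (there (here refl)))))
  family∈ D = there (there (there (there (there (there (here refl))))))
  family∈ E = there (there (there (there (there (there (there (here refl)))))))
  family∈ F = there (there (there (there (there (there (there (there (here refl))))))))
  offset∈ : ∀ o → o ∈ ₀ ∷ ₁ ∷ []
  offset∈ ₀ = here refl
  offset∈ ₁ = there (here refl)

∀-atom? : {P : Atom → Set} → (∀ s → Dec (P s)) → Dec (∀ s → P s)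
∀-atom? P? = map′ (λ all s → All.lookup all (atom∈atoms s)) (λ h → All.tabulate (λ {s} _ → h s))
                  (All.all? P? atoms)

∃-atom? : {P : Atom → Set} → (∀ s → Dec (P s)) → Dec (∃ P)
∃-atom? P? = map′ (λ some → let s , _ , p = find some in s , p) (λ (s , p) → lose (atom∈atoms s) p)
                  (Any.any? P? atoms)

atomVar : ℕ → Atom → Var
atomVar i (φ , o) = family φ (shift o i)

atomVar-injective : ∀ i {s s′} → atomVar i s ≡ atomVar i s′ → s ≡ s′
atomVar-injective i {φ , o} {ψ , o′} eq =
  let φ≡ψ , shifts = family-injective eq in cong₂ _,_ φ≡ψ (shift-injective i shifts)

==ᵛ-atomVar : ∀ i s s′ → (atomVar i s ==ᵛ atomVar i s′) ≡ ⌊ s ≟ᵃ s′ ⌋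
==ᵛ-atomVar i s s′ with s ≟ᵃ s′
... | yes refl = ==ᵛ-refl (atomVar i s)
... | no s≢s′  = ==ᵛ-≢ (s≢s′ ∘ atomVar-injective i)

data Window (i : ℕ) : Var → Set where
  inside  : ∀ s → Window i (atomVar i s)
  outside : ∀ {v} → (∀ s → atomVar i s ≢ v) → Window i v

insideAt : ∀ i v o → idx v ≡ shift o i → Window i v
insideAt i v o eq = subst (Window i) (trans (cong (family _) (sym eq)) (family-idx v))
                          (inside (familyOfTag (tag v) , o))

window : ∀ i v → Window i v
window i v with idx v ≟ i | idx v ≟ suc i
... | yes k≡i | _         = insideAt i v ₀ k≡i
... | no _    | yes k≡1+i = insideAt i v ₁ k≡1+i
... | no k≢i  | no k≢1+i  = outside away
  where
  away : ∀ s → atomVar i s ≢ v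
  away (φ , ₀) eq = k≢i   (sym (trans (sym (idx-family φ i)) (cong idx eq)))
  away (φ , ₁) eq = k≢1+i (sym (trans (sym (idx-family φ (suc i))) (cong idx eq)))

-- Constraint schemas

data SLit : Set where
  pos neg : Atom → SLit

atomOf : SLit → Atom
atomOf (pos s) = s
atomOf (neg s) = s

litAt : ℕ → SLit → Lit
litAt i (pos s) = pos (atomVar i s)
litAt i (neg s) = neg (atomVar i s)

Sum : Set
Sum = List (ℕ × SLit)

infix 7 _≥_
record Schema : Set where
  constructor _≥_
  field
    lhs : Sum
    rhs : ℕ
open Schema

at : ℕ → Schema → PB
at i (ts ≥ k) = map (map₂ (litAt i)) ts ≥ᴾ + k

termCoefˢ : Atom → ℕ × SLit → ℤ
termCoefˢ s (k , pos t) = if ⌊ t ≟ᵃ s ⌋ then + k else + 0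
termCoefˢ s (k , neg t) = if ⌊ t ≟ᵃ s ⌋ then - (+ k) else + 0

coefficient : Sum → Atom → ℤ
coefficient []       s = + 0
coefficient (t ∷ ts) s = termCoefˢ s t ℤ.+ coefficient ts s

coeff : Schema → Atom → ℤ
coeff R = coefficient (lhs R)

negMassˢ : Sum → ℕ
negMassˢ []                 = 0
negMassˢ ((k , pos _) ∷ ts) = negMassˢ ts
negMassˢ ((k , neg _) ∷ ts) = k ℕ.+ negMassˢ ts

ldegˢ : Schema → ℤ
ldegˢ R = + rhs R ℤ.- + negMassˢ (lhs R)

sizeˢ : Schema → ℕ
sizeˢ R = sum (map (bits ∘ proj₁) (lhs R)) ℕ.+ bits (rhs R)

lin-at-atom : ∀ i R s → lin (at i R) (atomVar i s) ≡ coeff R s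
lin-at-atom i ([] ≥ k) s = refl
lin-at-atom i (((k , ℓ) ∷ ts) ≥ m) s = cong₂ ℤ._+_ (term ℓ) (lin-at-atom i (ts ≥ m) s)
  where
  term : ∀ ℓ → termCoef (atomVar i s) (k , litAt i ℓ) ≡ termCoefˢ s (k , ℓ)
  term (pos t) = cong (if_then + k else + 0) (==ᵛ-atomVar i t s)
  term (neg t) = cong (if_then - (+ k) else + 0) (==ᵛ-atomVar i t s)

lin-at-outside : ∀ i R {v} → (∀ s → atomVar i s ≢ v) → lin (at i R) v ≡ + 0
lin-at-outside i ([] ≥ k) away = refl
lin-at-outside i (((k , ℓ) ∷ ts) ≥ m) {v} away = cong₂ ℤ._+_ (term ℓ) (lin-at-outside i (ts ≥ m) away)
  where
  term : ∀ ℓ → termCoef v (k , litAt i ℓ) ≡ + 0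
  term (pos t) = cong (if_then + k else + 0) (==ᵛ-≢ (away t))
  term (neg t) = cong (if_then - (+ k) else + 0) (==ᵛ-≢ (away t))

ldeg-at : ∀ i R → ldeg (at i R) ≡ ldegˢ R
ldeg-at i (ts ≥ k) = cong (λ m → + k ℤ.- + m) (negMass-at ts)
  where
  negMass-at : ∀ ts → negMass (map (map₂ (litAt i)) ts) ≡ negMassˢ ts
  negMass-at []                 = refl
  negMass-at ((m , pos _) ∷ ts) = negMass-at ts
  negMass-at ((m , neg _) ∷ ts) = cong (m ℕ.+_) (negMass-at ts)

sizePB-at : ∀ i R → sizePB (at i R) ≡ sizeˢ R
sizePB-at i (ts ≥ k) = cong (λ zs → sum zs ℕ.+ bits k) (sym (map-∘ ts))

lin-at-pointwise₁ : ∀ i (g : ℤ → ℤ) → g (+ 0) ≡ + 0 → ∀ R P →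
                    (∀ s → coeff R s ≡ g (coeff P s)) →
                    ∀ v → lin (at i R) v ≡ g (lin (at i P) v)
lin-at-pointwise₁ i g g0 R P h v with window i v
... | inside s     rewrite lin-at-atom i R s | lin-at-atom i P s = h s
... | outside away rewrite lin-at-outside i R away | lin-at-outside i P away = sym g0

lin-at-pointwise₂ : ∀ i (g : ℤ → ℤ → ℤ) → g (+ 0) (+ 0) ≡ + 0 → ∀ R P Q →
                    (∀ s → coeff R s ≡ g (coeff P s) (coeff Q s)) →
                    ∀ v → lin (at i R) v ≡ g (lin (at i P) v) (lin (at i Q) v)
lin-at-pointwise₂ i g g0 R P Q h v with window i v
... | inside s     rewrite lin-at-atom i R s | lin-at-atom i P s | lin-at-atom i Q s = h s
... | outside away rewrite lin-at-outside i R away | lin-at-outside i P away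
                         | lin-at-outside i Q away = sym g0

lin-at-except : ∀ i s₀ R P → (∀ s → s ≢ s₀ → coeff R s ≡ coeff P s) →
                ∀ v → v ≢ atomVar i s₀ → lin (at i R) v ≡ lin (at i P) v
lin-at-except i s₀ R P h v v≢s₀ with window i v
... | inside s     rewrite lin-at-atom i R s | lin-at-atom i P s = h s (v≢s₀ ∘ cong (atomVar i))
... | outside away rewrite lin-at-outside i R away | lin-at-outside i P away = refl

-- Checking schematic derivations

infix 4 _≈ˢ_
_≈ˢ_ : Schema → Schema → Set
R ≈ˢ P = (∀ s → coeff R s ≡ coeff P s) × ldegˢ R ≡ ldegˢ P

IsSum : Schema → Schema → Schema → Set
IsSum R P Q = (∀ s → coeff R s ≡ coeff P s ℤ.+ coeff Q s) × ldegˢ R ≡ ldegˢ P ℤ.+ ldegˢ Q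

IsSaturation : Schema → Schema → Set
IsSaturation R P = (∀ s → coeff R s ≡ satCoef (+ rhs P) (coeff P s)) × rhs R ≡ rhs P

IsWeakeningAt : Atom → Schema → Schema → Set
IsWeakeningAt s₀ R P = coeff R s₀ ≡ + 0
                     × (∀ s → s ≢ s₀ → coeff R s ≡ coeff P s)
                     × + rhs R ≡ + rhs P ℤ.- + ∣ coeff P s₀ ∣

IsWeakening : Schema → Schema → Set
IsWeakening R P = ∃ λ s₀ → IsWeakeningAt s₀ R P

literalAxiom : SLit → Schema
literalAxiom ℓ = ((1 , ℓ) ∷ []) ≥ 0

IsLiteralAxiom : Schema → Set
IsLiteralAxiom R = ∃ λ s → R ≈ˢ literalAxiom (pos s) ⊎ R ≈ˢ literalAxiom (neg s)

_≈ˢ?_ : ∀ R P → Dec (R ≈ˢ P)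
R ≈ˢ? P = ∀-atom? (λ s → coeff R s ℤ.≟ coeff P s) ×-dec ldegˢ R ℤ.≟ ldegˢ P

isSum? : ∀ R P Q → Dec (IsSum R P Q)
isSum? R P Q = ∀-atom? (λ s → coeff R s ℤ.≟ coeff P s ℤ.+ coeff Q s)
             ×-dec ldegˢ R ℤ.≟ ldegˢ P ℤ.+ ldegˢ Q

isSaturation? : ∀ R P → Dec (IsSaturation R P)
isSaturation? R P = ∀-atom? (λ s → coeff R s ℤ.≟ satCoef (+ rhs P) (coeff P s)) ×-dec rhs R ≟ rhs P

isWeakening? : ∀ R P → Dec (IsWeakening R P)
isWeakening? R P = ∃-atom? λ s₀ →
    coeff R s₀ ℤ.≟ + 0
  ×-dec ∀-atom? (λ s → ¬? (s ≟ᵃ s₀) →-dec coeff R s ℤ.≟ coeff P s)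
  ×-dec + rhs R ℤ.≟ + rhs P ℤ.- + ∣ coeff P s₀ ∣

isLiteralAxiom? : ∀ R → Dec (IsLiteralAxiom R)
isLiteralAxiom? R = ∃-atom? λ s → R ≈ˢ? literalAxiom (pos s) ⊎-dec R ≈ˢ? literalAxiom (neg s)

≈ˢ-sound : ∀ i R P → R ≈ˢ P → at i R ≈ at i P
≈ˢ-sound i R P (coeffs , dg) =
  lin-at-pointwise₁ i (λ z → z) refl R P coeffs , trans (ldeg-at i R) (trans dg (sym (ldeg-at i P)))

module _ {Γ ls : List PB} (i : ℕ) where

  literalAxiom-sound : ∀ R → IsLiteralAxiom R → Step Γ ls (at i R)
  literalAxiom-sound R (s , inj₁ R≈s) = axPos (atomVar i s) (≈ˢ-sound i R (literalAxiom (pos s)) R≈s)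
  literalAxiom-sound R (s , inj₂ R≈s̄) = axNeg (atomVar i s) (≈ˢ-sound i R (literalAxiom (neg s)) R≈s̄)

  sum-sound : ∀ {R P Q} → at i P ∈ ls → at i Q ∈ ls → IsSum R P Q → Step Γ ls (at i R)
  sum-sound {R} {P} {Q} mP mQ (coeffs , dg) =
    add mP mQ (lin-at-pointwise₂ i ℤ._+_ refl R P Q coeffs)
              (trans (ldeg-at i R) (trans dg (sym (cong₂ ℤ._+_ (ldeg-at i P) (ldeg-at i Q)))))

  saturation-sound : ∀ {R P} → at i P ∈ ls → IsSaturation R P → Step Γ ls (at i R)
  saturation-sound {R} {P} mP (coeffs , dg) =
    saturate mP (lin-at-pointwise₁ i (satCoef (+ rhs P)) refl R P coeffs) (cong +_ dg)

  weakening-sound : ∀ {R P} → at i P ∈ ls → IsWeakening R P → Step Γ ls (at i R)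
  weakening-sound {R} {P} mP (s₀ , dropped , others , dg) =
    weaken (atomVar i s₀) mP (trans (lin-at-atom i R s₀) dropped) (lin-at-except i s₀ R P others)
           (trans dg (cong (λ z → + rhs P ℤ.- + ∣ z ∣) (sym (lin-at-atom i P s₀))))

canonical-at : ∀ i R → Unique (map (atomOf ∘ proj₂) (lhs R)) → Canonical (at i R)
canonical-at i (ts ≥ k) u = subst Unique (sym (vars-at ts)) (Unique.map⁺ (atomVar-injective i) u)
  where
  vars-at : ∀ ts → map (litVar ∘ proj₂) (map (map₂ (litAt i)) ts) ≡ map (atomVar i) (map (atomOf ∘ proj₂) ts)
  vars-at []                 = refl
  vars-at ((_ , pos s) ∷ ts) = cong (atomVar i s ∷_) (vars-at ts)
  vars-at ((_ , neg s) ∷ ts) = cong (atomVar i s ∷_) (vars-at ts)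

-- A rule refers to earlier lines by their distance, 0 being the line just before it;
-- `weaken` and `axiom` leave the dropped variable and the literal to be found by the check.
data Rule : Set where
  premise axiom   : Rule
  add             : ℕ → ℕ → Rule
  saturate weaken : ℕ → Rule

infix 6 _by_
record Line : Set where
  constructor _by_
  field
    constraint : Schema
    rule       : Rule

Script : Set
Script = List Line

nth : List Schema → ℕ → Maybe Schema
nth []       _       = nothing
nth (P ∷ Ps) zero    = just P
nth (P ∷ Ps) (suc j) = nth Ps j

nth-∈ : ∀ Ps j {P} → nth Ps j ≡ just P → P ∈ Ps
nth-∈ (P ∷ Ps) zero    refl = here refl
nth-∈ (_ ∷ Ps) (suc j) eq   = there (nth-∈ Ps j eq)

AtLine : List Schema → ℕ → (Schema → Set) → Set
AtLine ctx j Φ = ∃ λ P → nth ctx j ≡ just P × Φ P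

atLine? : ∀ ctx j {Φ : Schema → Set} → (∀ P → Dec (Φ P)) → Dec (AtLine ctx j Φ)
atLine? ctx j Φ? with nth ctx j
... | nothing = no λ { (_ , () , _) }
... | just P  = map′ (λ φ → P , refl , φ) (λ { (_ , refl , φ) → φ }) (Φ? P)

Justified : (Ps ctx : List Schema) → Schema → Rule → Set
Justified Ps ctx R premise      = Any (R ≈ˢ_) Ps
Justified Ps ctx R axiom        = IsLiteralAxiom R
Justified Ps ctx R (add j k)    = AtLine ctx j λ P → AtLine ctx k λ Q → IsSum R P Q
Justified Ps ctx R (saturate j) = AtLine ctx j (IsSaturation R)
Justified Ps ctx R (weaken j)   = AtLine ctx j (IsWeakening R)

justified? : ∀ Ps ctx R r → Dec (Justified Ps ctx R r)
justified? Ps ctx R premise      = Any.any? (R ≈ˢ?_) Ps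
justified? Ps ctx R axiom        = isLiteralAxiom? R
justified? Ps ctx R (add j k)    = atLine? ctx j λ P → atLine? ctx k λ Q → isSum? R P Q
justified? Ps ctx R (saturate j) = atLine? ctx j (isSaturation? R)
justified? Ps ctx R (weaken j)   = atLine? ctx j (isWeakening? R)

Valid : (Ps ctx : List Schema) → Script → Set
Valid Ps ctx []                 = ⊤
Valid Ps ctx (R by r ∷ script) =
  Unique (map (atomOf ∘ proj₂) (lhs R)) × Justified Ps ctx R r × Valid Ps (R ∷ ctx) script

valid? : ∀ Ps ctx script → Dec (Valid Ps ctx script)
valid? Ps ctx []                 = yes tt
valid? Ps ctx (R by r ∷ script) =
  unique? (map (atomOf ∘ proj₂) (lhs R)) ×-dec justified? Ps ctx R r ×-dec valid? Ps (R ∷ ctx) script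

replay : List Schema → Script → List Schema
replay ctx []                 = ctx
replay ctx (R by _ ∷ script) = replay (R ∷ ctx) script

scriptSize : Script → ℕ
scriptSize = sum ∘ map (sizeˢ ∘ Line.constraint)

module _ {Γ : List PB} (i : ℕ) {Ps : List Schema} (premises : ∀ {P} → P ∈ Ps → at i P ∈ Γ) where

  nth-at-∈ : ∀ {ctx rest j P} → nth ctx j ≡ just P → at i P ∈ map (at i) ctx ++ rest
  nth-at-∈ {ctx} {j = j} eq = ∈-++⁺ˡ (∈-map⁺ (at i) (nth-∈ ctx j eq))

  justified-sound : ∀ ctx {rest} R r → Justified Ps ctx R r → Step Γ (map (at i) ctx ++ rest) (at i R)
  justified-sound ctx R premise R≈P =
    let P , P∈Ps , R≈P = find R≈P in premise (premises P∈Ps) (≈ˢ-sound i R P R≈P)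
  justified-sound ctx R axiom ax = literalAxiom-sound i R ax
  justified-sound ctx R (add j k) (P , eqP , Q , eqQ , sum) =
    sum-sound i (nth-at-∈ {ctx} eqP) (nth-at-∈ {ctx} eqQ) sum
  justified-sound ctx R (saturate j) (P , eqP , sat) = saturation-sound i (nth-at-∈ {ctx} eqP) sat
  justified-sound ctx R (weaken j) (P , eqP , weak) = weakening-sound i (nth-at-∈ {ctx} eqP) weak

  run : ∀ ctx script {rest} → Valid Ps ctx script →
        Deriv Γ (map (at i) ctx ++ rest) → Deriv Γ (map (at i) (replay ctx script) ++ rest)
  run ctx []                 _                        𝒟 = 𝒟
  run ctx (R by r ∷ script) (canonical , why , later) 𝒟 =
    run (R ∷ ctx) script later (𝒟 ▷ (canonical-at i R canonical , justified-sound ctx R r why))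

size-replay : ∀ i ctx script rest →
              size (map (at i) (replay ctx script) ++ rest) ≡ scriptSize script ℕ.+ size (map (at i) ctx ++ rest)
size-replay i ctx []                 rest = refl
size-replay i ctx (R by _ ∷ script) rest = begin
  size (map (at i) (replay (R ∷ ctx) script) ++ rest)  ≡⟨ size-replay i (R ∷ ctx) script rest ⟩
  scriptSize script ℕ.+ (sizePB (at i R) ℕ.+ below)  ≡⟨ cong (λ z → scriptSize script ℕ.+ (z ℕ.+ below)) (sizePB-at i R) ⟩
  scriptSize script ℕ.+ (sizeˢ R ℕ.+ below)          ≡⟨ +-assoc (scriptSize script) (sizeˢ R) below ⟨
  scriptSize script ℕ.+ sizeˢ R ℕ.+ below            ≡⟨ cong (ℕ._+ below) (+-comm (scriptSize script) (sizeˢ R)) ⟩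
  sizeˢ R ℕ.+ scriptSize script ℕ.+ below            ∎
  where
  open ≡-Reasoning
  below = size (map (at i) ctx ++ rest)

record Derives (Γ top : List PB) (s : ℕ) : Set where
  constructor derives
  field
    rest  : List PB
    lines : Deriv Γ (top ++ rest)
    small : size (top ++ rest) ≤ s

emptyDerivation : ∀ {Γ} → Derives Γ [] 0
emptyDerivation = derives [] [] z≤n

Derives-take : ∀ {Γ top s} n → Derives Γ top s → Derives Γ (take n top) s
Derives-take {top = top} n (derives rest 𝒟 size≤) =
  derives (drop n top ++ rest) (subst (Deriv _) split 𝒟) (subst (λ ls → size ls ≤ _) split size≤)
  where
  split : top ++ rest ≡ take n top ++ drop n top ++ rest
  split = trans (cong (_++ rest) (sym (take++drop≡id n top))) (++-assoc (take n top) (drop n top) rest)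

derivation : ∀ {Γ top s} T → Derives Γ top s → Any (_≈ T) top → DerivationOfSize≤ Γ T s
derivation T (derives rest 𝒟 size≤) T∈top = _ , 𝒟 , Any.++⁺ˡ T∈top , size≤

infixr 8 _⊕_
infixr 9 _·_
infix 10 ~_

var : Family → Offset → Sum
var φ o = (1 , pos (φ , o)) ∷ []

~_ : Sum → Sum
~_ = map (map₂ complement)
  where
  complement : SLit → SLit
  complement (pos s) = neg s
  complement (neg s) = pos s

_·_ : ℕ → Sum → Sum
k · ts = map (map₁ (k ℕ.*_)) ts

_⊕_ : Sum → Sum → Sum
_⊕_ = _++_

x₁ y₁ w₁ a₀ a₁ b₀ b₁ c₀ c₁ d₀ d₁ e₀ e₁ f₀ f₁ : Sum
x₁ = var X ₁
y₁ = var Y ₁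
w₁ = var W ₁
a₀ = var A ₀
a₁ = var A ₁
b₀ = var B ₀
b₁ = var B ₁
c₀ = var C ₀
c₁ = var C ₁
d₀ = var D ₀
d₁ = var D ₁
e₀ = var E ₀
e₁ = var E ₁
f₀ = var F ₀
f₁ = var F ₁

-- The S_lex constraints in a window

slexBaseˢ : (φ ψ α δ : Family) → List Schema
slexBaseˢ φ ψ α δ =
    ~ var α ₁ ⊕ var φ ₁ ⊕ ~ var ψ ₁ ≥ 1
  ∷ 2 · var α ₁ ⊕ ~ var φ ₁ ⊕ var ψ ₁ ≥ 2
  ∷ ~ var δ ₁ ⊕ var ψ ₁ ⊕ ~ var φ ₁ ≥ 1
  ∷ 2 · var δ ₁ ⊕ ~ var ψ ₁ ⊕ var φ ₁ ≥ 2
  ∷ []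

slexStepAˢ : (φ ψ α : Family) → List Schema
slexStepAˢ φ ψ α =
    3 · ~ var α ₁ ⊕ 2 · var α ₀ ⊕ var φ ₁ ⊕ ~ var ψ ₁ ≥ 3
  ∷ 2 · var α ₁ ⊕ 2 · ~ var α ₀ ⊕ ~ var φ ₁ ⊕ var ψ ₁ ≥ 2
  ∷ []

slexStepDˢ : (φ ψ α δ : Family) → List Schema
slexStepDˢ φ ψ α δ =
    4 · ~ var δ ₁ ⊕ 3 · var δ ₀ ⊕ ~ var α ₀ ⊕ var ψ ₁ ⊕ ~ var φ ₁ ≥ 4
  ∷ 4 · var δ ₁ ⊕ 3 · ~ var δ ₀ ⊕ var α ₀ ⊕ ~ var ψ ₁ ⊕ var φ ₁ ≥ 3
  ∷ []

Slexᶠ : (φ ψ α δ : Family) → ℕ → List PB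
Slexᶠ φ ψ α δ = Slex (family φ) (family ψ) (family α) (family δ)

slexBase-∈ : ∀ {φ ψ α δ n P} → P ∈ slexBaseˢ φ ψ α δ → at 0 P ∈ Slexᶠ φ ψ α δ n
slexBase-∈ (here refl)                         = here refl
slexBase-∈ (there (here refl))                 = there (here refl)
slexBase-∈ (there (there (here refl)))         = there (there (here refl))
slexBase-∈ (there (there (there (here refl)))) = there (there (there (here refl)))

slexStepA-∈ : ∀ {φ ψ α δ n j P} → j < n ∸ 2 → P ∈ slexStepAˢ φ ψ α → at (suc j) P ∈ Slexᶠ φ ψ α δ n
slexStepA-∈ {j = j} j< P∈ = there (there (there (there
  (∈-++⁺ˡ (∈-concat⁺′ (∈-map⁺ (at (suc j)) P∈) (∈-map⁺ _ (∈-applyUpTo⁺ suc j<)))))))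

slexStepD-∈ : ∀ {φ ψ α δ n j P} → j < n ∸ 1 → P ∈ slexStepDˢ φ ψ α δ → at (suc j) P ∈ Slexᶠ φ ψ α δ n
slexStepD-∈ {j = j} j< P∈ = there (there (there (there
  (∈-++⁺ʳ _ (∈-concat⁺′ (∈-map⁺ (at (suc j)) P∈) (∈-map⁺ _ (∈-applyUpTo⁺ suc j<)))))))

instances : (Family → Family → Family → Family → List Schema) → List Schema
instances g = g X Y A D ++ g Y W B E ++ g X W C F

instances-∈ : ∀ {g i n} → (∀ {φ ψ α δ P} → P ∈ g φ ψ α δ → at i P ∈ Slexᶠ φ ψ α δ n) →
              ∀ {P} → P ∈ instances g → at i P ∈ Γtrans n
instances-∈ {g} {n = n} inSlex P∈ with ∈-++⁻ (g X Y A D) P∈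
... | inj₁ p = ∈-++⁺ˡ (inSlex p)
... | inj₂ q with ∈-++⁻ (g Y W B E) q
...   | inj₁ p = ∈-++⁺ʳ (Slex x y a d n) (there (∈-++⁺ˡ (inSlex p)))
...   | inj₂ p = ∈-++⁺ʳ (Slex x y a d n) (there (∈-++⁺ʳ (Slex y w b e n) (there (inSlex p))))

orderPremises : List Schema
orderPremises = d₁ ≥ 1 ∷ e₁ ≥ 1 ∷ []

orderPremises-∈ : ∀ m {P} → P ∈ orderPremises → at m P ∈ Γtrans (suc m)
orderPremises-∈ m (here refl)         = ∈-++⁺ʳ (Slex x y a d (suc m)) (here refl)
orderPremises-∈ m (there (here refl)) =
  ∈-++⁺ʳ (Slex x y a d (suc m)) (there (∈-++⁺ʳ (Slex y w b e (suc m)) (here refl)))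

∈-++-cases : ∀ {Z : Set} {Q : Z → Set} {xs ys} → (∀ {z} → z ∈ xs → Q z) → (∀ {z} → z ∈ ys → Q z) →
             ∀ {z} → z ∈ xs ++ ys → Q z
∈-++-cases {xs = xs} onXs onYs z∈ = [ onXs , onYs ] (∈-++⁻ xs z∈)

basePremises stepPremises lastPremises : List Schema
basePremises = instances slexBaseˢ
stepPremises = instances (λ φ ψ α _ → slexStepAˢ φ ψ α) ++ instances slexStepDˢ
lastPremises = instances slexStepDˢ

basePremises-∈ : ∀ n {P} → P ∈ basePremises → at 0 P ∈ Γtrans n
basePremises-∈ n = instances-∈ (slexBase-∈ {n = n})

stepPremises-∈ : ∀ {m k P} → suc k < m → P ∈ stepPremises → at (suc k) P ∈ Γtrans (suc m)
stepPremises-∈ {m} sk<m = ∈-++-cases (instances-∈ (slexStepA-∈ {n = suc m} (∸-monoˡ-≤ 1 sk<m)))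
                                     (instances-∈ (slexStepD-∈ {n = suc m} (<-trans (n<1+n _) sk<m)))

lastPremises-∈ : ∀ m {P} → P ∈ lastPremises → at (suc m) P ∈ Γtrans (suc (suc m))
lastPremises-∈ m = instances-∈ (slexStepD-∈ {n = suc (suc m)} ≤-refl)

I₁ I₂ I₃ : Offset → Schema
I₁ o = ~ var D o ⊕ ~ var E o ⊕ var F o ≥ 1
I₂ o = ~ var C o ⊕ ~ var D o ⊕ ~ var E o ⊕ var A o ≥ 1
I₃ o = ~ var C o ⊕ ~ var D o ⊕ ~ var E o ⊕ var B o ≥ 1

invariants : Offset → List Schema
invariants o = I₁ o ∷ I₂ o ∷ I₃ o ∷ []

budget : ℕ
budget = 1000

runBlock : ∀ {Γ} i {Ps} → (∀ {P} → P ∈ Ps → at i P ∈ Γ) → ∀ ctx script →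
           Valid Ps ctx script → scriptSize script ≤ budget → ∀ k →
           Derives Γ (map (at i) ctx) (budget * k) → Derives Γ (map (at i) (replay ctx script)) (budget * suc k)
runBlock i premises ctx script valid small k (derives rest 𝒟 size≤) =
  derives rest (run i premises ctx script valid 𝒟)
    (begin
      size (map (at i) (replay ctx script) ++ rest)         ≡⟨ size-replay i ctx script rest ⟩
      scriptSize script ℕ.+ size (map (at i) ctx ++ rest)  ≤⟨ +-mono-≤ small size≤ ⟩
      budget ℕ.+ budget * k                                 ≡⟨ *-suc budget k ⟨
      budget * suc k                                        ∎)
  where open ≤-Reasoning

baseScript : Script
baseScript =
    2 · f₁ ⊕ ~ w₁ ⊕ x₁ ≥ 2       by premise
  ∷ 2 · f₁ ⊕ x₁ ≥ 1              by weaken 0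
  ∷ f₁ ⊕ x₁ ≥ 1                  by saturate 0
  ∷ ~ d₁ ⊕ y₁ ⊕ ~ x₁ ≥ 1         by premise
  ∷ ~ e₁ ⊕ w₁ ⊕ ~ y₁ ≥ 1         by premise
  ∷ 2 · f₁ ⊕ ~ w₁ ≥ 1            by weaken 4
  ∷ f₁ ⊕ ~ w₁ ≥ 1                by saturate 0
  ∷ f₁ ⊕ ~ d₁ ⊕ y₁ ≥ 1           by add 4 3
  ∷ f₁ ⊕ ~ d₁ ⊕ ~ e₁ ⊕ w₁ ≥ 1    by add 0 3
  ∷ 2 · f₁ ⊕ ~ d₁ ⊕ ~ e₁ ≥ 1     by add 0 2
  ∷ f₁ ⊕ ~ d₁ ⊕ ~ e₁ ≥ 1         by saturate 0
  ∷ 2 · a₁ ⊕ ~ x₁ ⊕ y₁ ≥ 2       by premise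
  ∷ 2 · a₁ ⊕ y₁ ≥ 1              by weaken 0
  ∷ a₁ ⊕ y₁ ≥ 1                  by saturate 0
  ∷ ~ c₁ ⊕ x₁ ⊕ ~ w₁ ≥ 1         by premise
  ∷ 2 · a₁ ⊕ ~ x₁ ≥ 1            by weaken 3
  ∷ a₁ ⊕ ~ x₁ ≥ 1                by saturate 0
  ∷ a₁ ⊕ ~ e₁ ⊕ w₁ ≥ 1           by add 3 12
  ∷ a₁ ⊕ ~ e₁ ⊕ ~ c₁ ⊕ x₁ ≥ 1    by add 0 3
  ∷ 2 · a₁ ⊕ ~ e₁ ⊕ ~ c₁ ≥ 1     by add 0 2
  ∷ a₁ ⊕ ~ e₁ ⊕ ~ c₁ ≥ 1         by saturate 0
  ∷ ~ d₁ ≥ 0                     by axiom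
  ∷ a₁ ⊕ ~ e₁ ⊕ ~ c₁ ⊕ ~ d₁ ≥ 1  by add 1 0
  ∷ 2 · b₁ ⊕ ~ y₁ ⊕ w₁ ≥ 2       by premise
  ∷ 2 · b₁ ⊕ w₁ ≥ 1              by weaken 0
  ∷ b₁ ⊕ w₁ ≥ 1                  by saturate 0
  ∷ 2 · b₁ ⊕ ~ y₁ ≥ 1            by weaken 2
  ∷ b₁ ⊕ ~ y₁ ≥ 1                by saturate 0
  ∷ ~ c₁ ⊕ x₁ ⊕ b₁ ≥ 1           by add 13 2
  ∷ ~ c₁ ⊕ b₁ ⊕ ~ d₁ ⊕ y₁ ≥ 1    by add 0 25
  ∷ ~ c₁ ⊕ 2 · b₁ ⊕ ~ d₁ ≥ 1     by add 0 2
  ∷ ~ c₁ ⊕ b₁ ⊕ ~ d₁ ≥ 1         by saturate 0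
  ∷ ~ e₁ ≥ 0                     by axiom
  ∷ ~ c₁ ⊕ b₁ ⊕ ~ d₁ ⊕ ~ e₁ ≥ 1  by add 1 0
  ∷ ~ c₁ ⊕ ~ d₁ ⊕ ~ e₁ ⊕ b₁ ≥ 1  by saturate 0
  ∷ ~ c₁ ⊕ ~ d₁ ⊕ ~ e₁ ⊕ a₁ ≥ 1  by saturate 12
  ∷ ~ d₁ ⊕ ~ e₁ ⊕ f₁ ≥ 1         by saturate 25
  ∷ []

stepScript : Script
stepScript =
    4 · ~ d₁ ⊕ 3 · d₀ ⊕ ~ a₀ ⊕ y₁ ⊕ ~ x₁ ≥ 4        by premise
  ∷ 4 · ~ e₁ ⊕ 3 · e₀ ⊕ ~ b₀ ⊕ w₁ ⊕ ~ y₁ ≥ 4        by premise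
  ∷ 4 · f₁ ⊕ 3 · ~ f₀ ⊕ c₀ ⊕ ~ w₁ ⊕ x₁ ≥ 3          by premise
  ∷ 4 · ~ d₁ ⊕ 3 · d₀ ⊕ y₁ ⊕ ~ x₁ ≥ 3               by weaken 2
  ∷ 4 · ~ d₁ ⊕ 3 · d₀ ⊕ ~ x₁ ≥ 2                    by weaken 0
  ∷ 4 · ~ d₁ ⊕ 3 · d₀ ≥ 1                           by weaken 0
  ∷ ~ d₁ ⊕ d₀ ≥ 1                                   by saturate 0
  ∷ 4 · ~ d₁ ⊕ ~ a₀ ⊕ y₁ ⊕ ~ x₁ ≥ 1                 by weaken 6
  ∷ ~ d₁ ⊕ ~ a₀ ⊕ y₁ ⊕ ~ x₁ ≥ 1                     by saturate 0
  ∷ 4 · ~ e₁ ⊕ 3 · e₀ ⊕ w₁ ⊕ ~ y₁ ≥ 3               by weaken 7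
  ∷ 4 · ~ e₁ ⊕ 3 · e₀ ⊕ ~ y₁ ≥ 2                    by weaken 0
  ∷ 4 · ~ e₁ ⊕ 3 · e₀ ≥ 1                           by weaken 0
  ∷ ~ e₁ ⊕ e₀ ≥ 1                                   by saturate 0
  ∷ 4 · ~ e₁ ⊕ ~ b₀ ⊕ w₁ ⊕ ~ y₁ ≥ 1                 by weaken 11
  ∷ ~ e₁ ⊕ ~ b₀ ⊕ w₁ ⊕ ~ y₁ ≥ 1                     by saturate 0
  ∷ 4 · f₁ ⊕ 3 · ~ f₀ ⊕ c₀ ⊕ x₁ ≥ 2                 by weaken 12
  ∷ 4 · f₁ ⊕ 3 · ~ f₀ ⊕ c₀ ≥ 1                      by weaken 0
  ∷ f₁ ⊕ ~ f₀ ⊕ c₀ ≥ 1                              by saturate 0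
  ∷ 4 · f₁ ⊕ 3 · ~ f₀ ⊕ ~ w₁ ⊕ x₁ ≥ 2               by weaken 15
  ∷ 4 · f₁ ⊕ 3 · ~ f₀ ⊕ ~ w₁ ≥ 1                    by weaken 0
  ∷ f₁ ⊕ ~ f₀ ⊕ ~ w₁ ≥ 1                            by saturate 0
  ∷ 4 · f₁ ⊕ 3 · ~ f₀ ⊕ ~ w₁ ⊕ x₁ ≥ 2               by weaken 18
  ∷ 4 · f₁ ⊕ 3 · ~ f₀ ⊕ x₁ ≥ 1                      by weaken 0
  ∷ f₁ ⊕ ~ f₀ ⊕ x₁ ≥ 1                              by saturate 0
  ∷ ~ e₀ ⊕ f₀ ⊕ ~ d₁ ≥ 1                            by add 24 17
  ∷ f₀ ⊕ ~ d₁ ⊕ ~ e₁ ≥ 1                            by add 0 12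
  ∷ f₁ ⊕ c₀ ⊕ ~ d₁ ⊕ ~ e₁ ≥ 1                       by add 8 0
  ∷ f₁ ⊕ ~ w₁ ⊕ ~ d₁ ⊕ ~ e₁ ≥ 1                     by add 6 1
  ∷ f₁ ⊕ x₁ ⊕ ~ d₁ ⊕ ~ e₁ ≥ 1                       by add 4 2
  ∷ ~ c₀ ⊕ ~ e₀ ⊕ a₀ ⊕ ~ d₁ ≥ 1                     by add 30 22
  ∷ ~ c₀ ⊕ a₀ ⊕ ~ d₁ ⊕ ~ e₁ ≥ 1                     by add 0 17
  ∷ ~ c₀ ⊕ 2 · ~ d₁ ⊕ ~ e₁ ⊕ y₁ ⊕ ~ x₁ ≥ 1          by add 0 22
  ∷ ~ c₀ ⊕ ~ d₁ ⊕ ~ e₁ ⊕ y₁ ⊕ ~ x₁ ≥ 1              by saturate 0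
  ∷ ~ c₀ ⊕ ~ e₀ ⊕ b₀ ⊕ ~ d₁ ≥ 1                     by add 35 26
  ∷ ~ c₀ ⊕ b₀ ⊕ ~ d₁ ⊕ ~ e₁ ≥ 1                     by add 0 21
  ∷ ~ c₀ ⊕ ~ d₁ ⊕ 2 · ~ e₁ ⊕ w₁ ⊕ ~ y₁ ≥ 1          by add 0 20
  ∷ ~ c₀ ⊕ ~ d₁ ⊕ ~ e₁ ⊕ w₁ ⊕ ~ y₁ ≥ 1              by saturate 0
  ∷ 2 · ~ c₀ ⊕ 2 · ~ d₁ ⊕ 2 · ~ e₁ ⊕ ~ x₁ ⊕ w₁ ≥ 1  by add 4 0
  ∷ ~ c₀ ⊕ ~ d₁ ⊕ ~ e₁ ⊕ ~ x₁ ⊕ w₁ ≥ 1              by saturate 0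
  ∷ 2 · ~ d₁ ⊕ 2 · ~ e₁ ⊕ ~ x₁ ⊕ w₁ ⊕ f₁ ≥ 1        by add 0 12
  ∷ ~ d₁ ⊕ ~ e₁ ⊕ ~ x₁ ⊕ w₁ ⊕ f₁ ≥ 1                by saturate 0
  ∷ 2 · ~ d₁ ⊕ 2 · ~ e₁ ⊕ w₁ ⊕ 2 · f₁ ≥ 1           by add 0 12
  ∷ ~ d₁ ⊕ ~ e₁ ⊕ w₁ ⊕ f₁ ≥ 1                       by saturate 0
  ∷ 2 · ~ d₁ ⊕ 2 · ~ e₁ ⊕ 2 · f₁ ≥ 1                by add 0 15
  ∷ ~ d₁ ⊕ ~ e₁ ⊕ f₁ ≥ 1                            by saturate 0
  ∷ 3 · ~ c₁ ⊕ 2 · c₀ ⊕ x₁ ⊕ ~ w₁ ≥ 3               by premise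
  ∷ 3 · ~ c₁ ⊕ 2 · c₀ ⊕ ~ w₁ ≥ 2                    by weaken 0
  ∷ 3 · ~ c₁ ⊕ 2 · c₀ ≥ 1                           by weaken 0
  ∷ ~ c₁ ⊕ c₀ ≥ 1                                   by saturate 0
  ∷ 3 · ~ c₁ ⊕ x₁ ⊕ ~ w₁ ≥ 1                        by weaken 3
  ∷ ~ c₁ ⊕ x₁ ⊕ ~ w₁ ≥ 1                            by saturate 0
  ∷ 2 · a₁ ⊕ 2 · ~ a₀ ⊕ ~ x₁ ⊕ y₁ ≥ 2               by premise
  ∷ 2 · a₁ ⊕ 2 · ~ a₀ ⊕ ~ x₁ ≥ 1                    by weaken 0
  ∷ a₁ ⊕ ~ a₀ ⊕ ~ x₁ ≥ 1                            by saturate 0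
  ∷ 2 · a₁ ⊕ 2 · ~ a₀ ⊕ y₁ ≥ 1                      by weaken 2
  ∷ a₁ ⊕ ~ a₀ ⊕ y₁ ≥ 1                              by saturate 0
  ∷ 2 · b₁ ⊕ 2 · ~ b₀ ⊕ ~ y₁ ⊕ w₁ ≥ 2               by premise
  ∷ 2 · b₁ ⊕ 2 · ~ b₀ ⊕ ~ y₁ ≥ 1                    by weaken 0
  ∷ b₁ ⊕ ~ b₀ ⊕ ~ y₁ ≥ 1                            by saturate 0
  ∷ 2 · b₁ ⊕ 2 · ~ b₀ ⊕ w₁ ≥ 1                      by weaken 2
  ∷ b₁ ⊕ ~ b₀ ⊕ w₁ ≥ 1                              by saturate 0
  ∷ a₀ ⊕ ~ d₁ ⊕ ~ e₁ ⊕ ~ c₁ ≥ 1                     by add 30 12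
  ∷ ~ d₁ ⊕ ~ e₁ ⊕ ~ c₁ ⊕ a₁ ⊕ ~ x₁ ≥ 1              by add 0 8
  ∷ ~ d₁ ⊕ ~ e₁ ⊕ ~ c₁ ⊕ a₁ ⊕ y₁ ≥ 1                by add 1 7
  ∷ ~ d₁ ⊕ ~ e₁ ⊕ w₁ ⊕ ~ y₁ ⊕ ~ c₁ ≥ 1              by add 27 15
  ∷ 2 · ~ d₁ ⊕ 2 · ~ e₁ ⊕ w₁ ⊕ 2 · ~ c₁ ⊕ a₁ ≥ 1    by add 0 1
  ∷ ~ d₁ ⊕ ~ e₁ ⊕ w₁ ⊕ ~ c₁ ⊕ a₁ ≥ 1                by saturate 0
  ∷ ~ d₁ ⊕ ~ e₁ ⊕ 2 · ~ c₁ ⊕ a₁ ⊕ x₁ ≥ 1            by add 0 16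
  ∷ ~ d₁ ⊕ ~ e₁ ⊕ ~ c₁ ⊕ a₁ ⊕ x₁ ≥ 1                by saturate 0
  ∷ 2 · ~ d₁ ⊕ 2 · ~ e₁ ⊕ 2 · ~ c₁ ⊕ 2 · a₁ ≥ 1     by add 0 6
  ∷ ~ d₁ ⊕ ~ e₁ ⊕ ~ c₁ ⊕ a₁ ≥ 1                     by saturate 0
  ∷ b₀ ⊕ ~ d₁ ⊕ ~ e₁ ⊕ ~ c₁ ≥ 1                     by add 36 22
  ∷ ~ d₁ ⊕ ~ e₁ ⊕ ~ c₁ ⊕ b₁ ⊕ ~ y₁ ≥ 1              by add 0 13
  ∷ ~ d₁ ⊕ ~ e₁ ⊕ ~ c₁ ⊕ b₁ ⊕ w₁ ≥ 1                by add 1 12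
  ∷ ~ d₁ ⊕ ~ e₁ ⊕ y₁ ⊕ ~ x₁ ⊕ ~ c₁ ≥ 1              by add 41 25
  ∷ 2 · ~ d₁ ⊕ 2 · ~ e₁ ⊕ ~ x₁ ⊕ 2 · ~ c₁ ⊕ b₁ ≥ 1  by add 0 2
  ∷ ~ d₁ ⊕ ~ e₁ ⊕ ~ x₁ ⊕ ~ c₁ ⊕ b₁ ≥ 1              by saturate 0
  ∷ ~ d₁ ⊕ ~ e₁ ⊕ 2 · ~ c₁ ⊕ b₁ ⊕ ~ w₁ ≥ 1          by add 0 26
  ∷ ~ d₁ ⊕ ~ e₁ ⊕ ~ c₁ ⊕ b₁ ⊕ ~ w₁ ≥ 1              by saturate 0
  ∷ 2 · ~ d₁ ⊕ 2 · ~ e₁ ⊕ 2 · ~ c₁ ⊕ 2 · b₁ ≥ 1     by add 0 5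
  ∷ ~ d₁ ⊕ ~ e₁ ⊕ ~ c₁ ⊕ b₁ ≥ 1                     by saturate 0
  ∷ ~ c₁ ⊕ ~ d₁ ⊕ ~ e₁ ⊕ b₁ ≥ 1                     by saturate 0
  ∷ ~ c₁ ⊕ ~ d₁ ⊕ ~ e₁ ⊕ a₁ ≥ 1                     by saturate 11
  ∷ ~ d₁ ⊕ ~ e₁ ⊕ f₁ ≥ 1                            by saturate 38
  ∷ []

lastScript : Script
lastScript =
    4 · ~ d₁ ⊕ 3 · d₀ ⊕ ~ a₀ ⊕ y₁ ⊕ ~ x₁ ≥ 4        by premise
  ∷ 4 · ~ e₁ ⊕ 3 · e₀ ⊕ ~ b₀ ⊕ w₁ ⊕ ~ y₁ ≥ 4        by premise
  ∷ 4 · f₁ ⊕ 3 · ~ f₀ ⊕ c₀ ⊕ ~ w₁ ⊕ x₁ ≥ 3          by premise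
  ∷ 4 · ~ d₁ ⊕ 3 · d₀ ⊕ y₁ ⊕ ~ x₁ ≥ 3               by weaken 2
  ∷ 4 · ~ d₁ ⊕ 3 · d₀ ⊕ ~ x₁ ≥ 2                    by weaken 0
  ∷ 4 · ~ d₁ ⊕ 3 · d₀ ≥ 1                           by weaken 0
  ∷ ~ d₁ ⊕ d₀ ≥ 1                                   by saturate 0
  ∷ 4 · ~ d₁ ⊕ ~ a₀ ⊕ y₁ ⊕ ~ x₁ ≥ 1                 by weaken 6
  ∷ ~ d₁ ⊕ ~ a₀ ⊕ y₁ ⊕ ~ x₁ ≥ 1                     by saturate 0
  ∷ 4 · ~ e₁ ⊕ 3 · e₀ ⊕ w₁ ⊕ ~ y₁ ≥ 3               by weaken 7
  ∷ 4 · ~ e₁ ⊕ 3 · e₀ ⊕ ~ y₁ ≥ 2                    by weaken 0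
  ∷ 4 · ~ e₁ ⊕ 3 · e₀ ≥ 1                           by weaken 0
  ∷ ~ e₁ ⊕ e₀ ≥ 1                                   by saturate 0
  ∷ 4 · ~ e₁ ⊕ ~ b₀ ⊕ w₁ ⊕ ~ y₁ ≥ 1                 by weaken 11
  ∷ ~ e₁ ⊕ ~ b₀ ⊕ w₁ ⊕ ~ y₁ ≥ 1                     by saturate 0
  ∷ 4 · f₁ ⊕ 3 · ~ f₀ ⊕ c₀ ⊕ x₁ ≥ 2                 by weaken 12
  ∷ 4 · f₁ ⊕ 3 · ~ f₀ ⊕ c₀ ≥ 1                      by weaken 0
  ∷ f₁ ⊕ ~ f₀ ⊕ c₀ ≥ 1                              by saturate 0
  ∷ 4 · f₁ ⊕ 3 · ~ f₀ ⊕ ~ w₁ ⊕ x₁ ≥ 2               by weaken 15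
  ∷ 4 · f₁ ⊕ 3 · ~ f₀ ⊕ ~ w₁ ≥ 1                    by weaken 0
  ∷ f₁ ⊕ ~ f₀ ⊕ ~ w₁ ≥ 1                            by saturate 0
  ∷ 4 · f₁ ⊕ 3 · ~ f₀ ⊕ ~ w₁ ⊕ x₁ ≥ 2               by weaken 18
  ∷ 4 · f₁ ⊕ 3 · ~ f₀ ⊕ x₁ ≥ 1                      by weaken 0
  ∷ f₁ ⊕ ~ f₀ ⊕ x₁ ≥ 1                              by saturate 0
  ∷ ~ e₀ ⊕ f₀ ⊕ ~ d₁ ≥ 1                            by add 24 17
  ∷ f₀ ⊕ ~ d₁ ⊕ ~ e₁ ≥ 1                            by add 0 12
  ∷ f₁ ⊕ c₀ ⊕ ~ d₁ ⊕ ~ e₁ ≥ 1                       by add 8 0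
  ∷ f₁ ⊕ ~ w₁ ⊕ ~ d₁ ⊕ ~ e₁ ≥ 1                     by add 6 1
  ∷ f₁ ⊕ x₁ ⊕ ~ d₁ ⊕ ~ e₁ ≥ 1                       by add 4 2
  ∷ ~ c₀ ⊕ ~ e₀ ⊕ a₀ ⊕ ~ d₁ ≥ 1                     by add 30 22
  ∷ ~ c₀ ⊕ a₀ ⊕ ~ d₁ ⊕ ~ e₁ ≥ 1                     by add 0 17
  ∷ ~ c₀ ⊕ 2 · ~ d₁ ⊕ ~ e₁ ⊕ y₁ ⊕ ~ x₁ ≥ 1          by add 0 22
  ∷ ~ c₀ ⊕ ~ d₁ ⊕ ~ e₁ ⊕ y₁ ⊕ ~ x₁ ≥ 1              by saturate 0
  ∷ ~ c₀ ⊕ ~ e₀ ⊕ b₀ ⊕ ~ d₁ ≥ 1                     by add 35 26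
  ∷ ~ c₀ ⊕ b₀ ⊕ ~ d₁ ⊕ ~ e₁ ≥ 1                     by add 0 21
  ∷ ~ c₀ ⊕ ~ d₁ ⊕ 2 · ~ e₁ ⊕ w₁ ⊕ ~ y₁ ≥ 1          by add 0 20
  ∷ ~ c₀ ⊕ ~ d₁ ⊕ ~ e₁ ⊕ w₁ ⊕ ~ y₁ ≥ 1              by saturate 0
  ∷ 2 · ~ c₀ ⊕ 2 · ~ d₁ ⊕ 2 · ~ e₁ ⊕ ~ x₁ ⊕ w₁ ≥ 1  by add 4 0
  ∷ ~ c₀ ⊕ ~ d₁ ⊕ ~ e₁ ⊕ ~ x₁ ⊕ w₁ ≥ 1              by saturate 0
  ∷ 2 · ~ d₁ ⊕ 2 · ~ e₁ ⊕ ~ x₁ ⊕ w₁ ⊕ f₁ ≥ 1        by add 0 12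
  ∷ ~ d₁ ⊕ ~ e₁ ⊕ ~ x₁ ⊕ w₁ ⊕ f₁ ≥ 1                by saturate 0
  ∷ 2 · ~ d₁ ⊕ 2 · ~ e₁ ⊕ w₁ ⊕ 2 · f₁ ≥ 1           by add 0 12
  ∷ ~ d₁ ⊕ ~ e₁ ⊕ w₁ ⊕ f₁ ≥ 1                       by saturate 0
  ∷ 2 · ~ d₁ ⊕ 2 · ~ e₁ ⊕ 2 · f₁ ≥ 1                by add 0 15
  ∷ ~ d₁ ⊕ ~ e₁ ⊕ f₁ ≥ 1                            by saturate 0
  ∷ []

concludeScript : Script
concludeScript =
    d₁ ≥ 1         by premise
  ∷ e₁ ≥ 1         by premise
  ∷ ~ e₁ ⊕ f₁ ≥ 1  by add 2 1
  ∷ f₁ ≥ 1         by add 0 1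
  ∷ []

baseScript-valid : Valid basePremises [] baseScript
baseScript-valid = from-yes (valid? basePremises [] baseScript)

stepScript-valid : Valid stepPremises (invariants ₀) stepScript
stepScript-valid = from-yes (valid? stepPremises (invariants ₀) stepScript)

baseConclude-valid : Valid (basePremises ++ orderPremises) [] (baseScript ++ concludeScript)
baseConclude-valid = from-yes (valid? (basePremises ++ orderPremises) [] (baseScript ++ concludeScript))

lastConclude-valid : Valid (lastPremises ++ orderPremises) (invariants ₀) (lastScript ++ concludeScript)
lastConclude-valid = from-yes (valid? (lastPremises ++ orderPremises) (invariants ₀) (lastScript ++ concludeScript))

-- baseScript and stepScript end with the invariants at offset ₁, which are the invariants of the next index.
invariants-at : ∀ m k → k < m → Derives (Γtrans (suc m)) (map (at (suc k)) (invariants ₀)) (budget * suc k)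
invariants-at m zero _ =
  Derives-take 3 (runBlock 0 (basePremises-∈ (suc m)) [] baseScript baseScript-valid (≤ᵇ⇒≤ _ _ tt)
                           0 emptyDerivation)
invariants-at m (suc k) sk<m =
  Derives-take 3 (runBlock (suc k) (stepPremises-∈ sk<m) (invariants ₀) stepScript stepScript-valid (≤ᵇ⇒≤ _ _ tt)
                           (suc k) (invariants-at m k (<-trans (n<1+n k) sk<m)))

lemma14 : ∃ λ C → ∀ n → 1 ≤ n → DerivationOfSize≤ (Γtrans n) (target n) (C * n)
lemma14 = budget , λ where
  (suc zero) _ →
    derivation (target 1)
      (runBlock 0 (∈-++-cases (basePremises-∈ 1) (orderPremises-∈ 0)) [] (baseScript ++ concludeScript)
                baseConclude-valid (≤ᵇ⇒≤ _ _ tt) 0 emptyDerivation)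
      (here ((λ _ → refl) , refl))
  (suc (suc m)) _ →
    derivation (target (suc (suc m)))
      (runBlock (suc m) (∈-++-cases (lastPremises-∈ m) (orderPremises-∈ (suc m))) (invariants ₀)
                (lastScript ++ concludeScript) lastConclude-valid (≤ᵇ⇒≤ _ _ tt)
                (suc m) (invariants-at (suc m) m ≤-refl))
      (here ((λ _ → refl) , refl))
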